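{- Let $\mathcal S$ denote the class of star forests. Then, as $d \to \infty$, \[ m_{\mathcal S}(d) \geq (1+o(1))\frac{\log d}{\log \log d}. \] That is, there is a function $f(d) \to 0$ as $d\to\infty$ such that $m_{\mathcal S}(d) \geq (1+f(d))\frac{\log d}{\log\log d}$ for all sufficiently large $d$.
   Context: All graphs are finite. A star forest is a graph each of whose connected components is a star (a graph $K_{1,s}$ for some $s\ge 0$, including single vertices and single edges). Given a family $\mathcal G=\{G_1,\dots,G_k\}$ of graphs all spanning a common vertex set $V$, a cooperative coloring of $\mathcal G$ is a family of sets $R_1,\dots,R_k\subseteq V$ such that each $R_i$ is an independent set of $G_i$ and $V=\bigcup_{i=1}^k R_i$. For a graph class $\mathcal H$, $m_{\mathcal H}(d)$ is the minimum value $m$ such that every family of at least $m$ graphs from $\mathcal H$, each of maximum degree at most $d$, spanning a common vertex set, has a cooperative coloring. Here $\log$ is the natural logarithm and asymptotics are as $d\to\infty$. -}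

module Defs where

open import Data.Nat using (ℕ; suc; _+_; _*_; _≤_; _<_)
open import Data.Nat.Logarithm using (⌊log₂_⌋)
open import Data.Bool using (Bool; true; false)
open import Data.Fin using (Fin)
open import Data.Fin.Subset using (Subset; _∈_; ∣_∣)
open import Data.Vec using (tabulate)
open import Data.Product using (Σ; ∃; _×_; _,_)
open import Data.Sum using (_⊎_)
open import Relation.Binary.PropositionalEquality using (_≡_; _≢_)
open import Relation.Binary.Construct.Closure.ReflexiveTransitive using (Star)
open import Function.Bundles using (_⇔_)
open import Relation.Nullary using (¬_)

record Graph (n : ℕ) : Set where
  field
    Adj   : Fin n → Fin n → Bool
    sym   : ∀ u v → Adj u v ≡ Adj v u
    irrefl : ∀ v → Adj v v ≡ false
open Graph public

Edge : ∀ {n} → Graph n → Fin n → Fin n → Set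
Edge G u v = Adj G u v ≡ true

nbhd : ∀ {n} → Graph n → Fin n → Subset n
nbhd G v = tabulate (Adj G v)

degree : ∀ {n} → Graph n → Fin n → ℕ
degree G v = ∣ nbhd G v ∣

MaxDegreeAtMost : ∀ {n} → ℕ → Graph n → Set
MaxDegreeAtMost d G = ∀ v → degree G v ≤ d

Reach : ∀ {n} → Graph n → Fin n → Fin n → Set
Reach G = Star (Edge G)

-- Every connected component is a star K_{1,s} (s ≥ 0): the component of x
-- has a centre c such that two vertices of the component are adjacent iff
-- they are distinct and one of them is the centre.
IsStarForest : ∀ {n} → Graph n → Set
IsStarForest {n} G =
  ∀ (x : Fin n) → Σ (Fin n) λ c → Reach G x c ×
    (∀ u v → Reach G x u → Reach G x v →
       (Edge G u v ⇔ (u ≢ v × (u ≡ c ⊎ v ≡ c))))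

Independent : ∀ {n} → Graph n → Subset n → Set
Independent G R = ∀ u v → u ∈ R → v ∈ R → Adj G u v ≡ false

CooperativeColoring : ∀ {n k} → (Fin k → Graph n) → Set
CooperativeColoring {n} {k} G =
  Σ (Fin k → Subset n) λ R →
    (∀ i → Independent (G i) (R i)) × (∀ v → ∃ λ i → v ∈ R i)

-- Failure at m: some family of at least m star forests of maximum degree
-- at most d on a common vertex set has no cooperative colouring.
-- (m_S(d) > m  iff  BadFamily d m.)
BadFamily : ℕ → ℕ → Set
BadFamily d m =
  Σ ℕ λ n → Σ ℕ λ k → Σ (Fin k → Graph n) λ G →
    m ≤ k × (∀ i → IsStarForest (G i)) × (∀ i → MaxDegreeAtMost d (G i))
    × ¬ CooperativeColoring G

{-# OPTIONS --safe #-}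
-- The family lives on a rooted tree: a vertex of level K+1 is the root or a vertex of
-- one of K+1 copies of level K. Graph j sends all of copy j to the root and acts inside
-- every other copy as graph (punchOut j) of that copy, joining each vertex to its
-- image; an idempotent "centre" map always yields a star forest this way. In a
-- cooperative colouring, if the root lies in the independent set of graph c, no vertex
-- of copy c can use graph c, so the other K graphs colour copy c; at level 0 no graph
-- is left. Level m has at most B ^ m vertices for any B > m, which bounds the degrees;
-- for B = 2 ^ a with a = ⌊log₂ ⌊log₂ d⌋⌋ this is at most d once a · m < ⌊log₂ d⌋.
module Submission where

open import Defs
open import Data.Nat using (ℕ; suc; _*_; _≤_; _<_)
open import Data.Nat.Logarithm using (⌊log₂_⌋)
open import Data.Product using (Σ)

open import Data.Nat using (zero; _^_; s≤s; z≤n)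
open import Data.Nat.Properties
  using (≤-refl; ≤-trans; <⇒≤; <⇒≱; ≰⇒>; ≮⇒≥; n≤1+n; n<1+n; *-assoc; *-comm;
         *-mono-≤; *-monoˡ-≤; *-monoʳ-≤; +-monoˡ-≤; *-cancelˡ-<; ^-*-assoc; m^n>0;
         module ≤-Reasoning)
open import Data.Nat.Logarithm using (⌊log₂⌋-mono-≤; ⌊log₂[2^n]⌋≡n)
open import Data.Fin using (Fin; punchIn; punchOut)
open import Data.Fin.Properties
  using (_≟_; ¬Fin0; 1↔⊤; +↔⊎; *↔×;
         punchInᵢ≢i; punchOut-cong; punchOut-punchIn; punchIn-punchOut)
open import Data.Fin.Subset using (_∈_)
open import Data.Fin.Subset.Properties using (∣p∣≤n)
open import Data.Unit using (⊤; tt)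
open import Data.Sum using (_⊎_; inj₁; inj₂)
import Data.Sum as Sum
open import Data.Sum.Properties using (inj₂-injective)
open import Data.Sum.Function.Propositional using (_⊎-↔_)
open import Data.Product using (_×_; _,_; proj₁; proj₂)
import Data.Product as Prod
open import Data.Product.Function.NonDependent.Propositional using (_×-↔_)
open import Function using (_∘_)
open import Function.Bundles using (_⇔_; mk⇔; _↔_; Inverse; Injection)
open import Function.Properties.Inverse using (↔-refl; ↔-sym; ↔-trans; Inverse⇒Injection)
open import Relation.Nullary using (¬_; Dec; yes; no; does; proof; contradiction; ¬?)
open import Relation.Nullary.Reflects using (Reflects; invert)
open import Relation.Nullary.Decidable
  using (_×-dec_; _⊎-dec_; dec-true; dec-false; does-⇔; decidable-stable)
open import Relation.Binary.PropositionalEquality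
  using (_≡_; _≢_; refl; trans; cong; subst; subst₂)
  renaming (sym to ≡-sym)
open import Relation.Binary.Construct.Closure.ReflexiveTransitive using (ε; _◅_)

-- The components are the fibres of κ, each a star centred at its fixed point.
module CentreGraph {n : ℕ} (κ : Fin n → Fin n) (κ-idem : ∀ x → κ (κ x) ≡ κ x) where

  Joined : Fin n → Fin n → Set
  Joined u v = u ≢ v × (u ≡ κ v ⊎ v ≡ κ u)

  Joined? : ∀ u v → Dec (Joined u v)
  Joined? u v = ¬? (u ≟ v) ×-dec (u ≟ κ v ⊎-dec v ≟ κ u)

  Joined-sym : ∀ {u v} → Joined u v → Joined v u
  Joined-sym (u≢v , u≡κv⊎v≡κu) = u≢v ∘ ≡-sym , Sum.swap u≡κv⊎v≡κu

  graph : Graph n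
  graph = record
    { Adj    = λ u v → does (Joined? u v)
    ; sym    = λ u v → does-⇔ (mk⇔ Joined-sym Joined-sym) (Joined? u v) (Joined? v u)
    ; irrefl = λ v → dec-false (Joined? v v) (λ (v≢v , _) → v≢v refl)
    }

  Edge⇒Joined : ∀ {u v} → Edge graph u v → Joined u v
  Edge⇒Joined {u} {v} e = invert (subst (Reflects (Joined u v)) e (proof (Joined? u v)))

  Joined⇒Edge : ∀ {u v} → Joined u v → Edge graph u v
  Joined⇒Edge {u} {v} = dec-true (Joined? u v)

  Edge⇒sameCentre : ∀ {u v} → Edge graph u v → κ u ≡ κ v
  Edge⇒sameCentre e with Edge⇒Joined e
  ... | _ , inj₁ u≡κv = trans (cong κ u≡κv) (κ-idem _)
  ... | _ , inj₂ v≡κu = ≡-sym (trans (cong κ v≡κu) (κ-idem _))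

  Reach⇒sameCentre : ∀ {u v} → Reach graph u v → κ u ≡ κ v
  Reach⇒sameCentre ε       = refl
  Reach⇒sameCentre (e ◅ r) = trans (Edge⇒sameCentre e) (Reach⇒sameCentre r)

  reach-centre : ∀ x → Reach graph x (κ x)
  reach-centre x with x ≟ κ x
  ... | yes x≡κx = subst (Reach graph x) x≡κx ε
  ... | no x≢κx  = Joined⇒Edge (x≢κx , inj₂ refl) ◅ ε

  Edge⇔inComponent : ∀ {u v c} → κ u ≡ c → κ v ≡ c →
                     Edge graph u v ⇔ (u ≢ v × (u ≡ c ⊎ v ≡ c))
  Edge⇔inComponent κu≡c κv≡c = mk⇔
    (Prod.map₂ (Sum.map (λ u≡κv → trans u≡κv κv≡c) (λ v≡κu → trans v≡κu κu≡c))
      ∘ Edge⇒Joined)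
    (Joined⇒Edge
      ∘ Prod.map₂ (Sum.map (λ u≡c → trans u≡c (≡-sym κv≡c)) (λ v≡c → trans v≡c (≡-sym κu≡c))))

  isStarForest : IsStarForest graph
  isStarForest x = κ x , reach-centre x , λ u v x↝u x↝v →
    Edge⇔inComponent (≡-sym (Reach⇒sameCentre x↝u)) (≡-sym (Reach⇒sameCentre x↝v))

  independent⇒fixed : ∀ {R u} → Independent graph R → u ∈ R → κ u ∈ R → u ≡ κ u
  independent⇒fixed {R} {u} ind u∈R κu∈R = decidable-stable (u ≟ κ u) λ u≢κu →
    contradiction (trans (≡-sym (Joined⇒Edge (u≢κu , inj₂ refl))) (ind u (κ u) u∈R κu∈R))
                  λ ()

Vertex : ℕ → Set
Vertex zero    = ⊤
Vertex (suc K) = ⊤ ⊎ (Fin (suc K) × Vertex K)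

pattern root     = inj₁ tt
pattern node c v = inj₂ (c , v)

centre : ∀ K → Fin K → Vertex K → Vertex K
centre (suc K) j root = root
centre (suc K) j (node c v) with c ≟ j
... | yes _   = root
... | no c≢j  = node c (centre K (punchOut c≢j) v)

centre-other : ∀ K {c j} v (c≢j : c ≢ j) →
               centre (suc K) j (node c v) ≡ node c (centre K (punchOut c≢j) v)
centre-other K {c} {j} v c≢j with c ≟ j
... | yes c≡j = contradiction c≡j c≢j
... | no _    = cong (λ i → node c (centre K i v)) (punchOut-cong c refl)

centre-own : ∀ K c v → centre (suc K) c (node c v) ≡ root
centre-own K c v with c ≟ c
... | yes _  = refl
... | no c≢c = contradiction refl c≢c

centre-punchIn : ∀ K c j v → centre (suc K) (punchIn c j) (node c v) ≡ node c (centre K j v)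
centre-punchIn K c j v = trans (centre-other K v (punchInᵢ≢i c j ∘ ≡-sym))
  (cong (λ i → node c (centre K i v)) (punchOut-punchIn c))

centre-idem : ∀ K j v → centre K j (centre K j v) ≡ centre K j v
centre-idem (suc K) j root = refl
centre-idem (suc K) j (node c v) with c ≟ j
... | yes _  = refl
... | no c≢j = trans (centre-other K _ c≢j) (cong (node c) (centre-idem K _ v))

ConflictFree : ∀ K → (Vertex K → Fin K) → Set
ConflictFree K col = ∀ j w → col w ≡ j → col (centre K j w) ≡ j → w ≡ centre K j w

¬conflictFree : ∀ K col → ¬ ConflictFree K col
¬conflictFree zero    col _    = ¬Fin0 (col tt)
¬conflictFree (suc K) col free = ¬conflictFree K col′ free′
  where
  c : Fin (suc K)
  c = col root

  avoids : ∀ v → c ≢ col (node c v)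
  avoids v c≡col
    with () ← trans (free c (node c v) (≡-sym c≡col) (cong col (centre-own K c v)))
                    (centre-own K c v)

  col′ : Vertex K → Fin K
  col′ v = punchOut (avoids v)

  col≡punchIn : ∀ v → col (node c v) ≡ punchIn c (col′ v)
  col≡punchIn v = ≡-sym (punchIn-punchOut (avoids v))

  free′ : ConflictFree K col′
  free′ j v col′v≡j col′cv≡j = cong proj₂ (inj₂-injective (trans
    (free (punchIn c j) (node c v)
      (trans (col≡punchIn v) (cong (punchIn c) col′v≡j))
      (trans (cong col (centre-punchIn K c j v))
        (trans (col≡punchIn (centre K j v)) (cong (punchIn c) col′cv≡j))))
    (centre-punchIn K c j v)))

size : ℕ → ℕ
size zero    = 1
size (suc K) = suc (suc K * size K)

Vertex↔Fin : ∀ K → Vertex K ↔ Fin (size K)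
Vertex↔Fin zero    = ↔-sym 1↔⊤
Vertex↔Fin (suc K) =
  ↔-trans (↔-sym 1↔⊤ ⊎-↔ ↔-trans (↔-refl ×-↔ Vertex↔Fin K) (↔-sym *↔×)) (↔-sym +↔⊎)

encode : ∀ K → Vertex K → Fin (size K)
encode K = Inverse.to (Vertex↔Fin K)

decode : ∀ K → Fin (size K) → Vertex K
decode K = Inverse.from (Vertex↔Fin K)

encode-injective : ∀ K {v w} → encode K v ≡ encode K w → v ≡ w
encode-injective K = Injection.injective (Inverse⇒Injection (Vertex↔Fin K))

centreFin : ∀ K → Fin K → Fin (size K) → Fin (size K)
centreFin K j = encode K ∘ centre K j ∘ decode K

centreFin-encode : ∀ K j w → centreFin K j (encode K w) ≡ encode K (centre K j w)
centreFin-encode K j w =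
  cong (encode K ∘ centre K j) (Inverse.strictlyInverseʳ (Vertex↔Fin K) w)

centreFin-idem : ∀ K j x → centreFin K j (centreFin K j x) ≡ centreFin K j x
centreFin-idem K j x = trans (centreFin-encode K j _) (cong (encode K) (centre-idem K j _))

starFamily : ∀ K → Fin K → Graph (size K)
starFamily K j = CentreGraph.graph (centreFin K j) (centreFin-idem K j)

starFamily-isStarForest : ∀ K j → IsStarForest (starFamily K j)
starFamily-isStarForest K j = CentreGraph.isStarForest (centreFin K j) (centreFin-idem K j)

starFamily-uncolourable : ∀ K → ¬ CooperativeColoring (starFamily K)
starFamily-uncolourable K (R , independent , covers) = ¬conflictFree K col conflictFree
  where
  col : Vertex K → Fin K
  col w = proj₁ (covers (encode K w))

  encode∈R : ∀ w → encode K w ∈ R (col w)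
  encode∈R w = proj₂ (covers (encode K w))

  conflictFree : ConflictFree K col
  conflictFree j w col[w]≡j col[cw]≡j = encode-injective K (trans
    (CentreGraph.independent⇒fixed (centreFin K j) (centreFin-idem K j) (independent j)
      (subst (λ i → encode K w ∈ R i) col[w]≡j (encode∈R w))
      (subst₂ (λ x i → x ∈ R i) (≡-sym (centreFin-encode K j w)) col[cw]≡j
        (encode∈R (centre K j w))))
    (centreFin-encode K j w))

badFamily : ∀ {d} m → size m ≤ d → BadFamily d m
badFamily m size≤d = size m , m , starFamily m , ≤-refl , starFamily-isStarForest m ,
  (λ j v → ≤-trans (∣p∣≤n (nbhd (starFamily m j) v)) size≤d) , starFamily-uncolourable m

size≤^ : ∀ K {B} → K < B → size K ≤ B ^ K
size≤^ zero    _ = s≤s z≤n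
size≤^ (suc K) {suc B} 1+K<1+B = begin
  suc (suc K * size K)      ≤⟨ s≤s (*-monoʳ-≤ (suc K) (size≤^ K (<⇒≤ 1+K<1+B))) ⟩
  suc (suc K * suc B ^ K)   ≤⟨ +-monoˡ-≤ (suc K * suc B ^ K) (m^n>0 (suc B) K) ⟩
  suc (suc K) * suc B ^ K   ≤⟨ *-monoˡ-≤ (suc B ^ K) 1+K<1+B ⟩
  suc B ^ suc K             ∎
  where open ≤-Reasoning

⌊log₂⌋<⇒<2^ : ∀ {n e} → ⌊log₂ n ⌋ < e → n < 2 ^ e
⌊log₂⌋<⇒<2^ {n} {e} lt = ≰⇒> λ 2^e≤n →
  <⇒≱ lt (subst (_≤ ⌊log₂ n ⌋) (⌊log₂[2^n]⌋≡n e) (⌊log₂⌋-mono-≤ 2^e≤n))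

<⌊log₂⌋⇒2^≤ : ∀ {n e} → e < ⌊log₂ n ⌋ → 2 ^ e ≤ n
<⌊log₂⌋⇒2^≤ {n} {e} lt = ≮⇒≥ λ n<2^e →
  <⇒≱ lt (subst (⌊log₂ n ⌋ ≤_) (⌊log₂[2^n]⌋≡n e) (⌊log₂⌋-mono-≤ (<⇒≤ n<2^e)))

size≤ : ∀ t {d} m → 16 ≤ d →
        suc t * m * ⌊log₂ ⌊log₂ d ⌋ ⌋ < t * ⌊log₂ d ⌋ → size m ≤ d
size≤ t {d} m 16≤d hyp = begin
  size m       ≤⟨ size≤^ m m<2^a ⟩
  (2 ^ a) ^ m  ≡⟨ ^-*-assoc 2 a m ⟩
  2 ^ (a * m)  ≤⟨ <⌊log₂⌋⇒2^≤ am<L ⟩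
  d            ∎
  where
  open ≤-Reasoning

  L a : ℕ
  L = ⌊log₂ d ⌋
  a = ⌊log₂ L ⌋

  am<L : a * m < L
  am<L = *-cancelˡ-< (suc t) (a * m) L (begin-strict
    suc t * (a * m)  ≡⟨ cong (suc t *_) (*-comm a m) ⟩
    suc t * (m * a)  ≡⟨ *-assoc (suc t) m a ⟨
    suc t * m * a    <⟨ hyp ⟩
    t * L            ≤⟨ *-monoˡ-≤ L (n≤1+n t) ⟩
    suc t * L        ∎)

  -- Uses a ≥ 2, which is what d ≥ 16 is needed for.
  m<2^a : m < 2 ^ a
  m<2^a = ≰⇒> λ 2^a≤m → <⇒≱ (⌊log₂⌋<⇒<2^ {L} (n<1+n a)) (begin
    2 * 2 ^ a  ≤⟨ *-mono-≤ (⌊log₂⌋-mono-≤ (⌊log₂⌋-mono-≤ 16≤d)) 2^a≤m ⟩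
    a * m      ≤⟨ <⇒≤ am<L ⟩
    L          ∎)

theorem1 : (t : ℕ) → Σ ℕ λ D → (d : ℕ) → D ≤ d → (m : ℕ) →
    suc t * m * ⌊log₂ ⌊log₂ d ⌋ ⌋ < t * ⌊log₂ d ⌋ → BadFamily d m
theorem1 t = 16 , λ d 16≤d m hyp → badFamily m (size≤ t m 16≤d hyp)
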